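{- Let $M\ge2$ be an even integer, $e\ge3$ an integer, and $\Lambda$ a finite abelian subgroup of $(\mathbb{R}/\mathbb{Z})^e$ with $\mathrm{wt}(\Lambda)=M$. Suppose $x=(x_1,\dots,x_e),x'=(x'_1,\dots,x'_e)\in\Lambda$ satisfy $\mathrm{wt}(x)=\mathrm{wt}(x')=M$ and $|\mathrm{supp}(x)\cap\mathrm{supp}(x')|=M/2$. Then $x_i,x'_i\in\{0,1/2\}$ for all $1\le i\le e$.
   Context: Each $x\in(\mathbb{R}/\mathbb{Z})^e$ is written with coordinates in $[0,1)$; $\mathrm{supp}(x)=\{i:x_i\ne0\}$, $\mathrm{wt}(x)=|\mathrm{supp}(x)|$, and $\mathrm{wt}(\Lambda)=\max_{x\in\Lambda}\mathrm{wt}(x)$.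
   Formalization: Λ is taken as a finite subgroup of (ℚ/ℤ)^e rather than of $(\mathbb{R}/\mathbb{Z})^e$, its elements being written with rational coordinates in [0,1). -}

module Defs where

open import Data.Nat using (ℕ)
open import Data.Fin using (Fin)
open import Data.Fin.Subset using (Subset; _∩_; ∣_∣)
open import Data.Bool using (Bool; not)
open import Data.Vec using (Vec; zipWith; map; replicate; lookup; tabulate)
open import Data.List using (List)
open import Data.List.Membership.Propositional using (_∈_)
import Data.List.Relation.Unary.All as LAll
import Data.Vec.Relation.Unary.All as VAll
open import Data.Product using (_×_; ∃-syntax)
open import Data.Rational using (ℚ; 0ℚ; 1ℚ; _+_; _-_; -_; _≤_; _<_; floor; _/_; _≟_)
open import Relation.Nullary.Decidable using (isYes)

-- Fractional part p - ⌊p⌋ ∈ [0,1)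
-- (floor division; stdlib's fracPart is NOT this for negative p)
frac : ℚ → ℚ
frac p = p - (floor p / 1)

InUnit : ℚ → Set
InUnit q = (0ℚ ≤ q) × (q < 1ℚ)

-- a point of (ℝ/ℤ)^e (torsion, hence rational coordinates), written with coords in [0,1)
Pt : ℕ → Set
Pt e = Vec ℚ e

_⊕_ : ∀ {e} → Pt e → Pt e → Pt e
x ⊕ y = zipWith (λ a b → frac (a + b)) x y

⊖_ : ∀ {e} → Pt e → Pt e
⊖ x = map (λ a → frac (- a)) x

𝟘 : ∀ {e} → Pt e
𝟘 = replicate _ 0ℚ

supp : ∀ {e} → Pt e → Subset e
supp x = tabulate (λ i → not (isYes (lookup x i ≟ 0ℚ)))

wt : ∀ {e} → Pt e → ℕ
wt x = ∣ supp x ∣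

record FiniteSubgroup (e : ℕ) : Set where
  field
    elems     : List (Pt e)
    normal    : LAll.All (VAll.All InUnit) elems
    zero-mem  : 𝟘 ∈ elems
    add-mem   : ∀ {x y} → x ∈ elems → y ∈ elems → (x ⊕ y) ∈ elems
    neg-mem   : ∀ {x} → x ∈ elems → (⊖ x) ∈ elems

open FiniteSubgroup public

_∈Λ_ : ∀ {e} → Pt e → FiniteSubgroup e → Set
x ∈Λ Λ = x ∈ elems Λ

WtEq : ∀ {e} → FiniteSubgroup e → ℕ → Set
WtEq Λ M = (∀ {x} → x ∈Λ Λ → wt x Data.Nat.≤ M) × (∃[ x ] (x ∈Λ Λ × wt x ≡ M))
  where open import Relation.Binary.PropositionalEquality using (_≡_)

module Submission where

-- Write X, X′ for the supports of x, x′.  They have M elements each and meet in M/2, so their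
-- symmetric difference X △ X′ also has M elements.  On X △ X′ exactly one of x, x′ vanishes, hence
-- x + x′ and x − x′ are nonzero there; as their weight is at most M, both vanish on X ∩ X′.  So on
-- X ∩ X′ we get x′ᵢ = −xᵢ and x′ᵢ = xᵢ, i.e. 2xᵢ = 0 with xᵢ ≠ 0, which forces xᵢ = x′ᵢ = 1/2.
-- Consequently 2x + x′ equals 1/2 on X ∩ X′ and x′ on X′ ∖ X, so its support contains X′ and, by
-- maximality of the weight, equals X′.  On X ∖ X′ this gives 2xᵢ = 0, so again xᵢ = 1/2.

open import Data.Bool using (not; _xor_)
open import Data.Fin using (Fin)
open import Data.Fin.Subset using (Subset; inside; outside; _∈_; _∉_; _⊆_; _∩_; ∣_∣)
open import Data.Fin.Subset.Properties using (_∈?_; p⊂q⇒∣p∣<∣q∣; ⊆-antisym; ∩-comm)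
open import Data.Integer as ℤ using (ℤ; +_; -[1+_]) renaming (suc to sucℤ)
import Data.Integer.Properties as ℤ
open import Data.Integer.DivMod using (_/ℕ_; [n/ℕd]*d≤n; n<s[n/ℕd]*d; div-pos-is-/ℕ)
import Data.List.Relation.Unary.All as LAll
open import Data.Nat as ℕ using (ℕ; _≤_; _*_; NonZero)
import Data.Nat.Coprimality as Coprimality
import Data.Nat.Properties as ℕ
import Data.Nat.Solver as ℕ
open import Data.Product using (_×_; _,_; proj₁; proj₂)
open import Data.Rational as ℚ using (ℚ; mkℚ; 0ℚ; 1ℚ; ½; _+_; _-_; -_; _<_; floor; _/_; _≟_; *≤*; *<*; _<?_)
import Data.Rational.Properties as ℚ
import Data.Rational.Solver as ℚ
open import Data.Sum using (_⊎_; inj₁; inj₂)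
open import Data.Vec using ([]; _∷_; lookup; zipWith; here; there)
open import Data.Vec.Properties using (lookup∘tabulate; lookup⇒[]=; []=⇒lookup; lookup-zipWith; lookup-map)
import Data.Vec.Relation.Unary.All as VAll
open import Data.Vec.Relation.Unary.All.Properties using (lookup⁺)
open import Function using (_∘_)
open import Relation.Binary.PropositionalEquality
open import Relation.Nullary using (yes; no; contradiction)
open import Relation.Nullary.Decidable using (does; isYes≗does; dec-true; dec-false; decidable-stable)

open import Defs

/ℕ-unique : ∀ {q} n d .{{_ : NonZero d}} →
            q ℤ.* + d ℤ.≤ n → n ℤ.< sucℤ q ℤ.* + d → n /ℕ d ≡ q
/ℕ-unique n d lo hi = ℤ.≤-antisym
  (<suc⇒≤ (ℤ.*-cancelʳ-<-nonNeg (+ d) (ℤ.≤-<-trans ([n/ℕd]*d≤n n d) hi)))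
  (<suc⇒≤ (ℤ.*-cancelʳ-<-nonNeg (+ d) (ℤ.≤-<-trans lo (n<s[n/ℕd]*d n d))))
  where
  <suc⇒≤ : ∀ {i j} → i ℤ.< sucℤ j → i ℤ.≤ j
  <suc⇒≤ {j = j} i<j = subst (_ ℤ.≤_) (ℤ.pred-suc j) (ℤ.i<j⇒i≤pred[j] i<j)

fromℤ : ℤ → ℚ
fromℤ z = mkℚ z 0 (Coprimality.sym (Coprimality.1-coprimeTo _))

floor-unique : ∀ z p → fromℤ z ℚ.≤ p → p < fromℤ (sucℤ z) → floor p ≡ z
floor-unique z (mkℚ n d-1 _) (*≤* lo) (*<* hi) = trans (div-pos-is-/ℕ n (ℕ.suc d-1))
  (/ℕ-unique n (ℕ.suc d-1) (subst (_ ℤ.≤_) (ℤ.*-identityʳ n) lo) (subst (ℤ._< _) (ℤ.*-identityʳ n) hi))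

frac-on-[0,1[ : ∀ {p} → InUnit p → frac p ≡ p
frac-on-[0,1[ {p} (lo , hi) = begin
  frac p   ≡⟨ cong (λ z → p - (z / 1)) (floor-unique (+ 0) p lo hi) ⟩
  p - 0ℚ   ≡⟨ ℚ.+-identityʳ p ⟩
  p        ∎
  where open ≡-Reasoning

frac-on-[1,2[ : ∀ {p} → 1ℚ ℚ.≤ p → p < 1ℚ + 1ℚ → frac p ≡ p - 1ℚ
frac-on-[1,2[ {p} lo hi = cong (λ z → p - (z / 1)) (floor-unique (+ 1) p lo hi)

frac-on-[-1,0[ : ∀ {p} → - 1ℚ ℚ.≤ p → p < 0ℚ → frac p ≡ p + 1ℚ
frac-on-[-1,0[ {p} lo hi = cong (λ z → p - (z / 1)) (floor-unique -[1+ 0 ] p lo hi)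

frac-neg : ∀ {u} → 0ℚ < u → u ℚ.≤ 1ℚ → frac (- u) ≡ - u + 1ℚ
frac-neg 0<u u≤1 = frac-on-[-1,0[ (ℚ.neg-antimono-≤ u≤1) (ℚ.neg-antimono-< 0<u)

0≤∧≢0⇒0< : ∀ {u} → 0ℚ ℚ.≤ u → u ≢ 0ℚ → 0ℚ < u
0≤∧≢0⇒0< {u} 0≤u u≢0 with 0ℚ <? u
... | yes 0<u = 0<u
... | no  0≮u = contradiction (ℚ.≤-antisym (ℚ.≮⇒≥ 0≮u) 0≤u) u≢0

u<1⇒0<-u+1 : ∀ {u} → u < 1ℚ → 0ℚ < - u + 1ℚ
u<1⇒0<-u+1 {u} u<1 = subst (_< - u + 1ℚ) (ℚ.+-inverseˡ u) (ℚ.+-monoʳ-< (- u) u<1)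

frac≡0⇒≡1 : ∀ {p} → 0ℚ < p → p < 1ℚ + 1ℚ → frac p ≡ 0ℚ → p ≡ 1ℚ
frac≡0⇒≡1 {p} 0<p p<2 frac≡0 with p <? 1ℚ
... | yes p<1 = contradiction (trans (sym (frac-on-[0,1[ (ℚ.<⇒≤ 0<p , p<1))) frac≡0) (ℚ.<⇒≢ 0<p ∘ sym)
... | no  p≮1 = begin
  p             ≡⟨ solve 1 (λ p → p := (p :+ (:- con 1ℚ)) :+ con 1ℚ) refl p ⟩
  p - 1ℚ + 1ℚ   ≡⟨ cong (_+ 1ℚ) (trans (sym (frac-on-[1,2[ (ℚ.≮⇒≥ p≮1) p<2)) frac≡0) ⟩
  0ℚ + 1ℚ       ∎
  where open ≡-Reasoning; open ℚ.+-*-Solver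

frac[u+v]≡0⇒v≡frac[-u] : ∀ {u v} → InUnit u → InUnit v → frac (u + v) ≡ 0ℚ → v ≡ frac (- u)
frac[u+v]≡0⇒v≡frac[-u] {u} {v} (0≤u , u<1) v∈ frac≡0 with u ≟ 0ℚ
... | yes refl = trans (sym (frac-on-[0,1[ v∈)) (trans (cong frac (sym (ℚ.+-identityˡ v))) frac≡0)
... | no  u≢0 = begin
  v               ≡⟨ solve 2 (λ u v → v := (:- u) :+ (u :+ v)) refl u v ⟩
  - u + (u + v)   ≡⟨ cong (λ w → - u + w) (frac≡0⇒≡1 0<u+v u+v<2 frac≡0) ⟩
  - u + 1ℚ        ≡⟨ frac-neg 0<u (ℚ.<⇒≤ u<1) ⟨
  frac (- u)      ∎
  where
  open ≡-Reasoning
  open ℚ.+-*-Solver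
  0<u = 0≤∧≢0⇒0< 0≤u u≢0
  0<u+v = ℚ.+-mono-<-≤ 0<u (proj₁ v∈)
  u+v<2 = ℚ.+-mono-< u<1 (proj₂ v∈)

u≡frac[-u]⇒u≡½ : ∀ {u} → 0ℚ < u → u < 1ℚ → u ≡ frac (- u) → u ≡ ½
u≡frac[-u]⇒u≡½ {u} 0<u u<1 u≡frac[-u] = begin
  u                        ≡⟨ solve 1 (λ u → u := con ½ :* (u :+ u)) refl u ⟩
  ½ ℚ.* (u + u)            ≡⟨ cong (λ w → ½ ℚ.* (u + w)) (trans u≡frac[-u] (frac-neg 0<u (ℚ.<⇒≤ u<1))) ⟩
  ½ ℚ.* (u + (- u + 1ℚ))   ≡⟨ solve 1 (λ u → con ½ :* (u :+ ((:- u) :+ con 1ℚ)) := con ½) refl u ⟩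
  ½                        ∎
  where open ≡-Reasoning; open ℚ.+-*-Solver

infixl 6 _△_
_△_ : ∀ {n} → Subset n → Subset n → Subset n
p △ q = zipWith _xor_ p q

x∈p△q⁻ : ∀ {n x} (p q : Subset n) → x ∈ p △ q → (x ∈ p × x ∉ q) ⊎ (x ∉ p × x ∈ q)
x∈p△q⁻ (inside  ∷ p) (outside ∷ q) here = inj₁ (here , λ ())
x∈p△q⁻ (outside ∷ p) (inside  ∷ q) here = inj₂ ((λ ()) , here)
x∈p△q⁻ (_ ∷ p) (_ ∷ q) (there x∈p△q) with x∈p△q⁻ p q x∈p△q
... | inj₁ (x∈p , x∉q) = inj₁ (there x∈p , λ { (there x∈q) → x∉q x∈q })
... | inj₂ (x∉p , x∈q) = inj₂ ((λ { (there x∈p) → x∉p x∈p }) , there x∈q)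

∣p∣+∣q∣≡∣p△q∣+2∣p∩q∣ : ∀ {n} (p q : Subset n) → ∣ p ∣ ℕ.+ ∣ q ∣ ≡ ∣ p △ q ∣ ℕ.+ 2 * ∣ p ∩ q ∣
∣p∣+∣q∣≡∣p△q∣+2∣p∩q∣ []            []            = refl
∣p∣+∣q∣≡∣p△q∣+2∣p∩q∣ (outside ∷ p) (outside ∷ q) = ∣p∣+∣q∣≡∣p△q∣+2∣p∩q∣ p q
∣p∣+∣q∣≡∣p△q∣+2∣p∩q∣ (inside  ∷ p) (outside ∷ q) = cong ℕ.suc (∣p∣+∣q∣≡∣p△q∣+2∣p∩q∣ p q)
∣p∣+∣q∣≡∣p△q∣+2∣p∩q∣ (outside ∷ p) (inside  ∷ q) =
  trans (ℕ.+-suc ∣ p ∣ ∣ q ∣) (cong ℕ.suc (∣p∣+∣q∣≡∣p△q∣+2∣p∩q∣ p q))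
∣p∣+∣q∣≡∣p△q∣+2∣p∩q∣ (inside  ∷ p) (inside  ∷ q) = begin
  ℕ.suc (∣ p ∣ ℕ.+ ℕ.suc ∣ q ∣)          ≡⟨ cong ℕ.suc (ℕ.+-suc ∣ p ∣ ∣ q ∣) ⟩
  2 ℕ.+ (∣ p ∣ ℕ.+ ∣ q ∣)                ≡⟨ cong (2 ℕ.+_) (∣p∣+∣q∣≡∣p△q∣+2∣p∩q∣ p q) ⟩
  2 ℕ.+ (∣ p △ q ∣ ℕ.+ 2 * ∣ p ∩ q ∣)    ≡⟨ solve 2 (λ d c → con 2 :+ (d :+ con 2 :* c) := d :+ con 2 :* (con 1 :+ c))
                                                     refl ∣ p △ q ∣ ∣ p ∩ q ∣ ⟩
  ∣ p △ q ∣ ℕ.+ 2 * ℕ.suc ∣ p ∩ q ∣      ∎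
  where open ≡-Reasoning; open ℕ.+-*-Solver

p⊆q⇒∣q∣≤∣p∣⇒q⊆p : ∀ {n} {p q : Subset n} → p ⊆ q → ∣ q ∣ ≤ ∣ p ∣ → q ⊆ p
p⊆q⇒∣q∣≤∣p∣⇒q⊆p {p = p} p⊆q ∣q∣≤∣p∣ {x} x∈q with x ∈? p
... | yes x∈p = x∈p
... | no  x∉p = contradiction (p⊂q⇒∣p∣<∣q∣ (p⊆q , x , x∈q , x∉p)) (ℕ.≤⇒≯ ∣q∣≤∣p∣)

module _ {e : ℕ} where

  lookup-supp : ∀ (z : Pt e) i → lookup (supp z) i ≡ not (does (lookup z i ≟ 0ℚ))
  lookup-supp z i = trans (lookup∘tabulate _ i) (cong not (isYes≗does (lookup z i ≟ 0ℚ)))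

  ∈supp⁺ : ∀ (z : Pt e) {i} → lookup z i ≢ 0ℚ → i ∈ supp z
  ∈supp⁺ z {i} z[i]≢0 =
    lookup⇒[]= i (supp z) (trans (lookup-supp z i) (cong not (dec-false (lookup z i ≟ 0ℚ) z[i]≢0)))

  ∈supp⁻ : ∀ (z : Pt e) {i} → i ∈ supp z → lookup z i ≢ 0ℚ
  ∈supp⁻ z {i} i∈supp z[i]≡0 = contradiction
    (trans (sym ([]=⇒lookup i∈supp)) (trans (lookup-supp z i) (cong not (dec-true (lookup z i ≟ 0ℚ) z[i]≡0))))
    λ ()

  ∉supp⇒≡0 : ∀ (z : Pt e) {i} → i ∉ supp z → lookup z i ≡ 0ℚ
  ∉supp⇒≡0 z {i} i∉supp = decidable-stable (lookup z i ≟ 0ℚ) (i∉supp ∘ ∈supp⁺ z)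

  lookup-⊕ : ∀ (x y : Pt e) i → lookup (x ⊕ y) i ≡ frac (lookup x i + lookup y i)
  lookup-⊕ x y i = lookup-zipWith _ i x y

  lookup-⊖ : ∀ (x : Pt e) i → lookup (⊖ x) i ≡ frac (- lookup x i)
  lookup-⊖ x i = lookup-map i _ x

  lookup-⊕-zeroʳ : ∀ (x y : Pt e) {i} → InUnit (lookup x i) → lookup y i ≡ 0ℚ →
                   lookup (x ⊕ y) i ≡ lookup x i
  lookup-⊕-zeroʳ x y {i} x[i]∈ y[i]≡0 = begin
    lookup (x ⊕ y) i                 ≡⟨ lookup-⊕ x y i ⟩
    frac (lookup x i + lookup y i)   ≡⟨ cong (λ w → frac (lookup x i + w)) y[i]≡0 ⟩
    frac (lookup x i + 0ℚ)           ≡⟨ cong frac (ℚ.+-identityʳ (lookup x i)) ⟩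
    frac (lookup x i)                ≡⟨ frac-on-[0,1[ x[i]∈ ⟩
    lookup x i                       ∎
    where open ≡-Reasoning

  lookup-⊕-zeroˡ : ∀ (x y : Pt e) {i} → InUnit (lookup y i) → lookup x i ≡ 0ℚ →
                   lookup (x ⊕ y) i ≡ lookup y i
  lookup-⊕-zeroˡ x y {i} y[i]∈ x[i]≡0 = begin
    lookup (x ⊕ y) i                 ≡⟨ lookup-⊕ x y i ⟩
    frac (lookup x i + lookup y i)   ≡⟨ cong (λ w → frac (w + lookup y i)) x[i]≡0 ⟩
    frac (0ℚ + lookup y i)           ≡⟨ cong frac (ℚ.+-identityˡ (lookup y i)) ⟩
    frac (lookup y i)                ≡⟨ frac-on-[0,1[ y[i]∈ ⟩
    lookup y i                       ∎
    where open ≡-Reasoning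

  supp△supp⊆supp-⊕ : ∀ {x y : Pt e} → VAll.All InUnit x → VAll.All InUnit y →
                     supp x △ supp y ⊆ supp (x ⊕ y)
  supp△supp⊆supp-⊕ {x} {y} x∈ y∈ {i} i∈△ with x∈p△q⁻ (supp x) (supp y) i∈△
  ... | inj₁ (i∈x , i∉y) = ∈supp⁺ (x ⊕ y)
    (subst (_≢ 0ℚ) (sym (lookup-⊕-zeroʳ x y (lookup⁺ x∈ i) (∉supp⇒≡0 y i∉y))) (∈supp⁻ x i∈x))
  ... | inj₂ (i∉x , i∈y) = ∈supp⁺ (x ⊕ y)
    (subst (_≢ 0ℚ) (sym (lookup-⊕-zeroˡ x y (lookup⁺ y∈ i) (∉supp⇒≡0 x i∉x))) (∈supp⁻ y i∈y))

  supp-⊖ : ∀ {x : Pt e} → VAll.All InUnit x → supp (⊖ x) ≡ supp x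
  supp-⊖ {x} x∈ = ⊆-antisym supp[⊖x]⊆supp[x] supp[x]⊆supp[⊖x]
    where
    supp[⊖x]⊆supp[x] : supp (⊖ x) ⊆ supp x
    supp[⊖x]⊆supp[x] {i} i∈ = ∈supp⁺ x λ x[i]≡0 →
      ∈supp⁻ (⊖ x) i∈ (trans (lookup-⊖ x i) (cong (λ w → frac (- w)) x[i]≡0))
    supp[x]⊆supp[⊖x] : supp x ⊆ supp (⊖ x)
    supp[x]⊆supp[⊖x] {i} i∈ = ∈supp⁺ (⊖ x) λ ⊖x[i]≡0 → ℚ.<⇒≢ (u<1⇒0<-u+1 x[i]<1) (begin
      0ℚ                  ≡⟨ ⊖x[i]≡0 ⟨
      lookup (⊖ x) i      ≡⟨ lookup-⊖ x i ⟩
      frac (- lookup x i) ≡⟨ frac-neg (0≤∧≢0⇒0< 0≤x[i] (∈supp⁻ x i∈)) (ℚ.<⇒≤ x[i]<1) ⟩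
      - lookup x i + 1ℚ   ∎)
      where
      open ≡-Reasoning
      0≤x[i] = proj₁ (lookup⁺ x∈ i)
      x[i]<1 = proj₂ (lookup⁺ x∈ i)

module _ {e : ℕ} (Λ : FiniteSubgroup e) where

  unit-coords : ∀ {z} → z ∈Λ Λ → VAll.All InUnit z
  unit-coords = LAll.lookup (normal Λ)

  module _ {M : ℕ} (wt≤M : ∀ {z} → z ∈Λ Λ → wt z ≤ M) where

    ⊆supp⇒supp⊆ : ∀ {z S} → z ∈Λ Λ → S ⊆ supp z → ∣ S ∣ ≡ M → supp z ⊆ S
    ⊆supp⇒supp⊆ {z} z∈Λ S⊆supp ∣S∣≡M =
      p⊆q⇒∣q∣≤∣p∣⇒q⊆p S⊆supp (subst (wt z ≤_) (sym ∣S∣≡M) (wt≤M z∈Λ))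

    module HalfOverlap {k : ℕ} (M≡2k : M ≡ 2 * k) {x x′ : Pt e} (x∈Λ : x ∈Λ Λ) (x′∈Λ : x′ ∈Λ Λ)
                       (wt[x]≡M : wt x ≡ M) (wt[x′]≡M : wt x′ ≡ M) (∣∩∣≡k : ∣ supp x ∩ supp x′ ∣ ≡ k) where

      ∣supp△supp∣≡M : ∣ supp x △ supp x′ ∣ ≡ M
      ∣supp△supp∣≡M = ℕ.+-cancelʳ-≡ M _ _ (begin
        ∣ supp x △ supp x′ ∣ ℕ.+ M                          ≡⟨ cong (∣ supp x △ supp x′ ∣ ℕ.+_) M≡2∣∩∣ ⟩
        ∣ supp x △ supp x′ ∣ ℕ.+ 2 * ∣ supp x ∩ supp x′ ∣   ≡⟨ ∣p∣+∣q∣≡∣p△q∣+2∣p∩q∣ (supp x) (supp x′) ⟨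
        wt x ℕ.+ wt x′                                      ≡⟨ cong₂ ℕ._+_ wt[x]≡M wt[x′]≡M ⟩
        M ℕ.+ M                                             ∎)
        where
        open ≡-Reasoning
        M≡2∣∩∣ = trans M≡2k (cong (2 *_) (sym ∣∩∣≡k))

      ⊕-vanishes-on-∩ : ∀ {w i} → w ∈Λ Λ → supp w ≡ supp x′ →
                        i ∈ supp x → i ∈ supp x′ → frac (lookup x i + lookup w i) ≡ 0ℚ
      ⊕-vanishes-on-∩ {w} {i} w∈Λ supp[w]≡supp[x′] i∈x i∈x′ =
        trans (sym (lookup-⊕ x w i)) (∉supp⇒≡0 (x ⊕ w) i∉supp[x⊕w])
        where
        supp[x⊕w]⊆△ : supp (x ⊕ w) ⊆ supp x △ supp w
        supp[x⊕w]⊆△ = ⊆supp⇒supp⊆ (add-mem Λ x∈Λ w∈Λ)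
          (supp△supp⊆supp-⊕ (unit-coords x∈Λ) (unit-coords w∈Λ))
          (subst (λ W → ∣ supp x △ W ∣ ≡ M) (sym supp[w]≡supp[x′]) ∣supp△supp∣≡M)
        i∉supp[x⊕w] : i ∉ supp (x ⊕ w)
        i∉supp[x⊕w] i∈ with x∈p△q⁻ (supp x) (supp w) (supp[x⊕w]⊆△ i∈)
        ... | inj₁ (_ , i∉w) = i∉w (subst (i ∈_) (sym supp[w]≡supp[x′]) i∈x′)
        ... | inj₂ (i∉x , _) = i∉x i∈x

      ≡½-on-∩ : ∀ {i} → i ∈ supp x → i ∈ supp x′ → lookup x i ≡ ½ × lookup x′ i ≡ ½
      ≡½-on-∩ {i} i∈x i∈x′ = a≡½ , trans b≡frac[-a] (cong (λ w → frac (- w)) a≡½)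
        where
        a = lookup x i
        b = lookup x′ i
        a∈ = lookup⁺ (unit-coords x∈Λ) i
        b∈ = lookup⁺ (unit-coords x′∈Λ) i
        frac[-b]∈ : InUnit (frac (- b))
        frac[-b]∈ = subst InUnit (lookup-⊖ x′ i) (lookup⁺ (unit-coords (neg-mem Λ x′∈Λ)) i)
        a+b≡0 : frac (a + b) ≡ 0ℚ
        a+b≡0 = ⊕-vanishes-on-∩ x′∈Λ refl i∈x i∈x′
        a-b≡0 : frac (a + frac (- b)) ≡ 0ℚ
        a-b≡0 = subst (λ w → frac (a + w) ≡ 0ℚ) (lookup-⊖ x′ i)
          (⊕-vanishes-on-∩ (neg-mem Λ x′∈Λ) (supp-⊖ (unit-coords x′∈Λ)) i∈x i∈x′)
        b≡frac[-a] : b ≡ frac (- a)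
        b≡frac[-a] = frac[u+v]≡0⇒v≡frac[-u] a∈ b∈ a+b≡0
        a≡½ : a ≡ ½
        a≡½ = u≡frac[-u]⇒u≡½ (0≤∧≢0⇒0< (proj₁ a∈) (∈supp⁻ x i∈x)) (proj₂ a∈) (begin
          a            ≡⟨ frac[u+v]≡0⇒v≡frac[-u] b∈ a∈ (subst (λ w → frac w ≡ 0ℚ) (ℚ.+-comm a b) a+b≡0) ⟩
          frac (- b)   ≡⟨ frac[u+v]≡0⇒v≡frac[-u] a∈ frac[-b]∈ a-b≡0 ⟩
          frac (- a)   ∎)
          where open ≡-Reasoning

      2x+x′ : Pt e
      2x+x′ = (x ⊕ x′) ⊕ x

      2x+x′∈Λ : 2x+x′ ∈Λ Λ
      2x+x′∈Λ = add-mem Λ (add-mem Λ x∈Λ x′∈Λ) x∈Λ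

      supp[x′]⊆supp[2x+x′] : supp x′ ⊆ supp 2x+x′
      supp[x′]⊆supp[2x+x′] {j} j∈x′ with j ∈? supp x
      ... | yes j∈x = ∈supp⁺ 2x+x′ (subst (_≢ 0ℚ) (sym 2x+x′[j]≡½) λ ())
        where
        open ≡-Reasoning
        2x+x′[j]≡½ : lookup 2x+x′ j ≡ ½
        2x+x′[j]≡½ = begin
          lookup 2x+x′ j                                        ≡⟨ lookup-⊕ (x ⊕ x′) x j ⟩
          frac (lookup (x ⊕ x′) j + lookup x j)                 ≡⟨ cong (λ w → frac (w + lookup x j))
                                                                        (lookup-⊕ x x′ j) ⟩
          frac (frac (lookup x j + lookup x′ j) + lookup x j)   ≡⟨ cong₂ (λ u v → frac (frac (u + v) + u))
                                                                         (proj₁ halves) (proj₂ halves) ⟩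
          frac (frac (½ + ½) + ½)                               ≡⟨⟩
          ½                                                     ∎
          where halves = ≡½-on-∩ j∈x j∈x′
      ... | no  j∉x = ∈supp⁺ 2x+x′ (subst (_≢ 0ℚ) (sym 2x+x′[j]≡x′[j]) (∈supp⁻ x′ j∈x′))
        where
        x[j]≡0 = ∉supp⇒≡0 x j∉x
        2x+x′[j]≡x′[j] : lookup 2x+x′ j ≡ lookup x′ j
        2x+x′[j]≡x′[j] = trans
          (lookup-⊕-zeroʳ (x ⊕ x′) x (lookup⁺ (unit-coords (add-mem Λ x∈Λ x′∈Λ)) j) x[j]≡0)
          (lookup-⊕-zeroˡ x x′ (lookup⁺ (unit-coords x′∈Λ) j) x[j]≡0)

      ≡½-on-supp : ∀ {i} → i ∈ supp x → lookup x i ≡ ½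
      ≡½-on-supp {i} i∈x with i ∈? supp x′
      ... | yes i∈x′ = proj₁ (≡½-on-∩ i∈x i∈x′)
      ... | no  i∉x′ = u≡frac[-u]⇒u≡½ (0≤∧≢0⇒0< (proj₁ a∈) (∈supp⁻ x i∈x)) (proj₂ a∈)
                         (frac[u+v]≡0⇒v≡frac[-u] a∈ a∈ a+a≡0)
        where
        a = lookup x i
        a∈ = lookup⁺ (unit-coords x∈Λ) i
        i∉supp[2x+x′] : i ∉ supp 2x+x′
        i∉supp[2x+x′] = i∉x′ ∘ ⊆supp⇒supp⊆ 2x+x′∈Λ supp[x′]⊆supp[2x+x′] wt[x′]≡M
        a+a≡0 : frac (a + a) ≡ 0ℚ
        a+a≡0 = begin
          frac (a + a)                   ≡⟨ cong (λ w → frac (w + a)) (lookup-⊕-zeroʳ x x′ a∈ (∉supp⇒≡0 x′ i∉x′)) ⟨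
          frac (lookup (x ⊕ x′) i + a)   ≡⟨ lookup-⊕ (x ⊕ x′) x i ⟨
          lookup 2x+x′ i                 ≡⟨ ∉supp⇒≡0 2x+x′ i∉supp[2x+x′] ⟩
          0ℚ                             ∎
          where open ≡-Reasoning

      ≡0⊎≡½ : ∀ i → lookup x i ≡ 0ℚ ⊎ lookup x i ≡ ½
      ≡0⊎≡½ i with i ∈? supp x
      ... | yes i∈x = inj₂ (≡½-on-supp i∈x)
      ... | no  i∉x = inj₁ (∉supp⇒≡0 x i∉x)

lemma2p4 : (M e k : ℕ) → M ≡ 2 * k → 2 ≤ M → 3 ≤ e →
    (Λ : FiniteSubgroup e) → WtEq Λ M →
    (x x′ : Pt e) → x ∈Λ Λ → x′ ∈Λ Λ →
    wt x ≡ M → wt x′ ≡ M → ∣ supp x ∩ supp x′ ∣ ≡ k →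
    (i : Fin e) →
    (lookup x i ≡ 0ℚ ⊎ lookup x i ≡ ½) × (lookup x′ i ≡ 0ℚ ⊎ lookup x′ i ≡ ½)
lemma2p4 M e k M≡2k _ _ Λ (wt≤M , _) x x′ x∈Λ x′∈Λ wt[x]≡M wt[x′]≡M ∣∩∣≡k i =
  HalfOverlap.≡0⊎≡½ Λ wt≤M M≡2k x∈Λ x′∈Λ wt[x]≡M wt[x′]≡M ∣∩∣≡k i ,
  HalfOverlap.≡0⊎≡½ Λ wt≤M M≡2k x′∈Λ x∈Λ wt[x′]≡M wt[x]≡M ∣∩∣′≡k i
  where
  ∣∩∣′≡k = trans (cong ∣_∣ (∩-comm (supp x′) (supp x))) ∣∩∣≡k
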